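{- Let $p,p'$ be coprime with $1\le p<p'$, and suppose $p'/p$ has continued fraction $[c_0,c_1,\ldots,c_n]$ with either $n\ge3$ and $c_0=c_1=c_2=1$, or $n=3$ and $c_0=c_1=1$, $c_2=2$. Then for $\Delta\in\{1,-1\}$ there is no integer $a$ with $1\le a<p'$ and $1\le a+5\Delta<p'$ such that each of $a+\Delta$, $a+2\Delta$, $a+4\Delta$ is interfacial in the $(p,p')$-model and $\rho^{p,p'}(a+\Delta)=\rho^{p,p'}(a+2\Delta)$.
   Context: The continued fraction $[c_0,\ldots,c_n]$ of $p'/p$ has $c_i\ge1$ ($i<n$), $c_n\ge2$, and $p'/p=c_0+1/(c_1+1/(\cdots+1/c_n))$. For $2\le a\le p'-2$, $a$ is interfacial in the $(p,p')$-model if $\lfloor (a+1)p/p'\rfloor=\lfloor (a-1)p/p'\rfloor+1$; $0$ and $p'$ are always interfacial, $1$ and $p'-1$ never. $\rho^{p,p'}(a)=\lfloor (a+1)p/p'\rfloor$. -}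

module Defs where

open import Data.Nat using (ℕ; zero; suc; _+_; _*_; _∸_; _≤_; _/_)
open import Data.List using (List; []; _∷_)
open import Data.Product using (_×_; _,_; proj₁; proj₂)
open import Data.Sum using (_⊎_)
open import Relation.Binary.PropositionalEquality using (_≡_)

-- floor division m / n, with the (never used) convention m / 0 = 0
fdiv : ℕ → ℕ → ℕ
fdiv m zero    = 0
fdiv m (suc n) = m / suc n

-- Value of a finite continued fraction [c₀,…,cₙ] as (numerator , denominator):
-- [c] = c/1, [c₀, rest] = c₀ + 1/[rest].  (The empty list encodes ∞ = 1/0.)
cfEval : List ℕ → ℕ × ℕ
cfEval []       = 1 , 0
cfEval (c ∷ cs) = c * proj₁ (cfEval cs) + proj₂ (cfEval cs) , proj₁ (cfEval cs)

data ValidCF : List ℕ → Set where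
  last : ∀ {c} → 2 ≤ c → ValidCF (c ∷ [])
  cons : ∀ {c d ds} → 1 ≤ c → ValidCF (d ∷ ds) → ValidCF (c ∷ d ∷ ds)

IsCF : ℕ → ℕ → List ℕ → Set
IsCF p' p cs = ValidCF cs × (p' * proj₂ (cfEval cs) ≡ p * proj₁ (cfEval cs))

Interfacial : ℕ → ℕ → ℕ → Set
Interfacial p p' a =
  a ≡ 0 ⊎ a ≡ p' ⊎
  (2 ≤ a × a ≤ p' ∸ 2 × fdiv ((a + 1) * p) p' ≡ suc (fdiv ((a ∸ 1) * p) p'))

ρ : ℕ → ℕ → ℕ → ℕ
ρ p p' a = fdiv ((a + 1) * p) p'

{-# OPTIONS --safe #-}
module Submission where

-- Write β(k) = ⌊kp/p'⌋, so ρ(b) = β(b + 1) and an interfacial b with 0 < b < p' satisfies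
-- β(b + 1) = β(b − 1) + 1.  In either direction the hypotheses chain into β(k + 5) = β(k) + 2
-- for some 0 < k < p'.  On the other hand p'/p = [1, 1, x] with x = [c₂, …, cₙ] ≤ 2 + 1/den x,
-- which together with coprimality gives 3p' ≤ 5p + 1.  As p' ∤ kp, this makes
-- β(k + 5) − β(k) = ⌊(kp mod p' + 5p)/p'⌋ ≥ ⌊(5p + 1)/p'⌋ ≥ 3.

open import Defs
open import Data.Nat using (ℕ; _<_; _≤_; _+_; _*_)
open import Data.Nat.Coprimality using (Coprime)
open import Data.Integer using (ℤ; +_; -_; ∣_∣)
open import Data.List using (List; []; _∷_)
open import Data.Product using (Σ; _×_; _,_; ∃; ∃-syntax)
open import Data.Sum using (_⊎_)
open import Relation.Nullary using (¬_)
open import Relation.Binary.PropositionalEquality using (_≡_)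

open import Data.Nat using (suc; _/_; _%_; NonZero; >-nonZero; s≤s; z≤n)
open import Data.Nat.Properties
open import Data.Nat.Divisibility using (_∣_; m%n≡0⇒n∣m; ∣⇒≤; m∣m*n)
open import Data.Nat.DivMod using (m≡m%n+[m/n]*n; m%n<n)
open import Data.Nat.Tactic.RingSolver using (solve)
open import Algebra.Properties.CommutativeSemigroup +-commutativeSemigroup using (xy∙z≈y∙xz)
import Data.Nat.Coprimality as Coprimality
import Data.Integer as ℤ
open import Data.Integer using (-[1+_]; +≤+; +<+)
open import Data.Sum using (inj₁; inj₂)
open import Data.Product using (proj₁; proj₂)
open import Relation.Nullary using (contradiction)
open import Relation.Binary.PropositionalEquality using (_≢_; refl; sym; trans; cong; subst; module ≡-Reasoning)

beatty : ℕ → ℕ → ℕ → ℕ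
beatty p p' k = fdiv (k * p) p'

ρ≡beatty-suc : ∀ p p' b → ρ p p' b ≡ beatty p p' (suc b)
ρ≡beatty-suc p p' b = cong (λ c → fdiv (c * p) p') (+-comm b 1)

ρ-flat⇒beatty-flat : ∀ {p p' b c} → ρ p p' b ≡ ρ p p' c → beatty p p' (suc b) ≡ beatty p p' (suc c)
ρ-flat⇒beatty-flat {p} {p'} {b} {c} flat =
  trans (sym (ρ≡beatty-suc p p' b)) (trans flat (ρ≡beatty-suc p p' c))

interfacial⇒jump : ∀ {p p' b} → suc b < p' → Interfacial p p' (suc b) →
                   beatty p p' (2 + b) ≡ suc (beatty p p' b)
interfacial⇒jump _     (inj₁ ())
interfacial⇒jump b<p' (inj₂ (inj₁ refl)) = contradiction refl (<⇒≢ b<p')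
interfacial⇒jump {p} {p'} {b} _ (inj₂ (inj₂ (_ , _ , jump))) =
  trans (sym (ρ≡beatty-suc p p' (suc b))) jump

ascending-double-jump : ∀ {p p' k} → 4 + k < p' →
  Interfacial p p' (1 + k) → Interfacial p p' (4 + k) → ρ p p' (1 + k) ≡ ρ p p' (2 + k) →
  beatty p p' (5 + k) ≡ 2 + beatty p p' k
ascending-double-jump {p} {p'} {k} 4+k<p' i₁ i₄ flat = begin
  beatty p p' (5 + k)        ≡⟨ interfacial⇒jump {p} 4+k<p' i₄ ⟩
  suc (beatty p p' (3 + k))  ≡⟨ cong suc (ρ-flat⇒beatty-flat {p} {p'} {2 + k} {1 + k} (sym flat)) ⟩
  suc (beatty p p' (2 + k))  ≡⟨ cong suc (interfacial⇒jump {p} (≤-trans (m≤n+m (2 + k) 3) 4+k<p') i₁) ⟩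
  2 + beatty p p' k          ∎
  where open ≡-Reasoning

descending-double-jump : ∀ {p p' k} → 3 + k < p' →
  Interfacial p p' (1 + k) → Interfacial p p' (3 + k) → ρ p p' (4 + k) ≡ ρ p p' (3 + k) →
  beatty p p' (5 + k) ≡ 2 + beatty p p' k
descending-double-jump {p} {p'} {k} 3+k<p' i₁ i₃ flat = begin
  beatty p p' (5 + k)        ≡⟨ ρ-flat⇒beatty-flat {p} {p'} {4 + k} {3 + k} flat ⟩
  beatty p p' (4 + k)        ≡⟨ interfacial⇒jump {p} 3+k<p' i₃ ⟩
  suc (beatty p p' (2 + k))  ≡⟨ cong suc (interfacial⇒jump {p} (≤-trans (m≤n+m (2 + k) 2) 3+k<p') i₁) ⟩
  2 + beatty p p' k          ∎
  where open ≡-Reasoning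

[y+x]/n≡j+x/n⇒x%n+y<[1+j]*n : ∀ x y j n .{{_ : NonZero n}} →
  (y + x) / n ≡ j + x / n → x % n + y < suc j * n
[y+x]/n≡j+x/n⇒x%n+y<[1+j]*n x y j n eq = +-cancelʳ-< (x / n * n) (x % n + y) (suc j * n) (begin-strict
  x % n + y + x / n * n          ≡⟨ xy∙z≈y∙xz (x % n) y (x / n * n) ⟩
  y + (x % n + x / n * n)        ≡⟨ cong (_+_ y) (sym (m≡m%n+[m/n]*n x n)) ⟩
  y + x                          ≡⟨ m≡m%n+[m/n]*n (y + x) n ⟩
  (y + x) % n + (y + x) / n * n  <⟨ +-monoˡ-< ((y + x) / n * n) (m%n<n (y + x) n) ⟩
  n + (y + x) / n * n            ≡⟨ cong (λ q → n + q * n) eq ⟩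
  n + (j + x / n) * n            ≡⟨ cong (_+_ n) (*-distribʳ-+ n j (x / n)) ⟩
  n + (j * n + x / n * n)        ≡⟨ +-assoc n (j * n) (x / n * n) ⟨
  suc j * n + x / n * n          ∎)
  where open ≤-Reasoning

¬beatty-jump : ∀ {p p'} j m {k} → Coprime p p' → suc j * p' ≤ m * p + 1 → 0 < k → k < p' →
  beatty p p' (m + k) ≢ j + beatty p p' k
¬beatty-jump {p} {suc n} j m {k} coprime bound 0<k k<p' jump =
  contradiction (∣⇒≤ {{>-nonZero 0<k}} p'∣k) (<⇒≱ k<p')
  where
  p' = suc n
  jump′ : (m * p + k * p) / p' ≡ j + k * p / p'
  jump′ = trans (cong (_/ p') (sym (*-distribʳ-+ p m k))) jump
  remainder≡0 : k * p % p' ≡ 0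
  remainder≡0 = n≤0⇒n≡0 (+-cancelʳ-≤ (m * p) (k * p % p') 0 (m<1+n⇒m≤n
    (<-≤-trans ([y+x]/n≡j+x/n⇒x%n+y<[1+j]*n (k * p) (m * p) j p' jump′)
               (subst (suc j * p' ≤_) (+-comm (m * p) 1) bound))))
  p'∣k : p' ∣ k
  p'∣k = Coprimality.coprime-divisor (Coprimality.sym coprime)
           (subst (p' ∣_) (*-comm k p) (m%n≡0⇒n∣m (k * p) p' remainder≡0))

num den : List ℕ → ℕ
num cs = proj₁ (cfEval cs)
den cs = proj₂ (cfEval cs)

den≤num : ∀ {cs} → ValidCF cs → den cs ≤ num cs
den≤num (last {c} 2≤c) = subst (1 ≤_) (sym (trans (+-identityʳ (c * 1)) (*-identityʳ c))) (<⇒≤ 2≤c)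
den≤num (cons {c} {d} {ds} 1≤c _) =
  ≤-trans (m≤n*m (num (d ∷ ds)) c {{>-nonZero 1≤c}}) (m≤m+n (c * num (d ∷ ds)) (den (d ∷ ds)))

0<den : ∀ {cs} → ValidCF cs → 0 < den cs
0<den (last _)   = s≤s z≤n
0<den (cons _ v) = ≤-trans (0<den v) (den≤num v)

1∷-num≤2*den : ∀ {ds} → ValidCF ds → num (1 ∷ ds) ≤ 2 * den (1 ∷ ds)
1∷-num≤2*den {ds} v = begin
  1 * num ds + den ds  ≤⟨ +-monoʳ-≤ (1 * num ds) (den≤num v) ⟩
  1 * num ds + num ds  ≡⟨ cong (_+ num ds) (*-identityˡ (num ds)) ⟩
  num ds + num ds      ≡⟨ cong (_+_ (num ds)) (+-identityʳ (num ds)) ⟨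
  2 * num ds           ∎
  where open ≤-Reasoning

IsCF-1∷1∷ : ∀ {p p' ds} → IsCF p' p (1 ∷ 1 ∷ ds) → p' * (num ds + den ds) ≡ p * (2 * num ds + den ds)
IsCF-1∷1∷ {p} {p'} {ds} (_ , eq) with cfEval ds
... | u , v = begin
  p' * (u + v)               ≡⟨ cong (_*_ p') (solve (u ∷ v ∷ [])) ⟩
  p' * (1 * u + v)           ≡⟨ eq ⟩
  p * (1 * (1 * u + v) + u)  ≡⟨ cong (_*_ p) (solve (u ∷ v ∷ [])) ⟩
  p * (2 * u + v)            ∎
  where open ≡-Reasoning

-- With x = u/v, p'/p = (2x + 1)/(x + 1) and x ≤ 2 + 1/v give 3p' ≤ 5p + p/(u + v),
-- and p ∣ u + v because p/p' is reduced.
coprime-[1,1,x]-bound : ∀ {p p' u v} → Coprime p p' → 0 < u + v → u ≤ 2 * v + 1 →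
  p' * (u + v) ≡ p * (2 * u + v) → 3 * p' ≤ 5 * p + 1
coprime-[1,1,x]-bound {p} {p'} {u} {v} coprime 0<u+v u≤2v+1 eq =
  *-cancelʳ-≤ (3 * p') (5 * p + 1) (u + v) {{>-nonZero 0<u+v}} (begin
    3 * p' * (u + v)                   ≡⟨ *-assoc 3 p' (u + v) ⟩
    3 * (p' * (u + v))                 ≡⟨ cong (_*_ 3) eq ⟩
    3 * (p * (2 * u + v))              ≡⟨ solve (p ∷ u ∷ v ∷ []) ⟩
    p * (u + (5 * u + 3 * v))          ≤⟨ *-monoʳ-≤ p (+-monoˡ-≤ (5 * u + 3 * v) u≤2v+1) ⟩
    p * (2 * v + 1 + (5 * u + 3 * v))  ≡⟨ solve (p ∷ u ∷ v ∷ []) ⟩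
    5 * p * (u + v) + p                ≤⟨ +-monoʳ-≤ (5 * p * (u + v)) p≤u+v ⟩
    5 * p * (u + v) + (u + v)          ≡⟨ solve (p ∷ u ∷ v ∷ []) ⟩
    (5 * p + 1) * (u + v)              ∎)
  where
  open ≤-Reasoning
  p≤u+v : p ≤ u + v
  p≤u+v = ∣⇒≤ {{>-nonZero 0<u+v}}
            (Coprimality.coprime-divisor coprime (subst (p ∣_) (sym eq) (m∣m*n (2 * u + v))))

IsCF⇒3p'≤5p+1 : ∀ {p p' cs} → Coprime p p' → IsCF p' p cs →
  ((∃[ c₃ ] ∃[ rest ] cs ≡ 1 ∷ 1 ∷ 1 ∷ c₃ ∷ rest) ⊎ (∃[ c₃ ] cs ≡ 1 ∷ 1 ∷ 2 ∷ c₃ ∷ [])) →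
  3 * p' ≤ 5 * p + 1
IsCF⇒3p'≤5p+1 {p} {p'} coprime isCF@(cons _ (cons _ valid@(cons _ valid′)) , _) (inj₁ (c₃ , rest , refl)) =
  coprime-[1,1,x]-bound coprime
    (≤-trans (0<den valid) (m≤n+m _ (num (1 ∷ c₃ ∷ rest))))
    (≤-trans (1∷-num≤2*den valid′) (m≤m+n _ 1))
    (IsCF-1∷1∷ {p} {p'} isCF)
IsCF⇒3p'≤5p+1 {p} {p'} coprime isCF (inj₂ (c₃ , refl)) =
  coprime-[1,1,x]-bound {v = v} coprime (≤-trans (m≤n+m 1 (2 * v)) (m≤m+n _ v)) ≤-refl (IsCF-1∷1∷ {p} {p'} isCF)
  where
  v = den (2 ∷ c₃ ∷ [])

Window : ℕ → ℕ → ℤ → ℤ → Set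
Window p p' Δ a =
  (+ 1 ℤ.≤ a) × (a ℤ.< + p') × (+ 1 ℤ.≤ a ℤ.+ (+ 5) ℤ.* Δ) × (a ℤ.+ (+ 5) ℤ.* Δ ℤ.< + p') ×
  Interfacial p p' ∣ a ℤ.+ Δ ∣ × Interfacial p p' ∣ a ℤ.+ (+ 2) ℤ.* Δ ∣ × Interfacial p p' ∣ a ℤ.+ (+ 4) ℤ.* Δ ∣ ×
  ρ p p' ∣ a ℤ.+ Δ ∣ ≡ ρ p p' ∣ a ℤ.+ (+ 2) ℤ.* Δ ∣

window⇒double-jump : ∀ {p p' Δ} → (Δ ≡ + 1 ⊎ Δ ≡ - (+ 1)) → ∀ a → Window p p' Δ a →
  ∃[ k ] 0 < k × k < p' × beatty p p' (5 + k) ≡ 2 + beatty p p' k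
window⇒double-jump {p} {p'} (inj₁ refl) (+ suc m) (_ , +<+ k<p' , _ , +<+ k+5<p' , i₁ , _ , i₄ , flat) =
  suc m , s≤s z≤n , k<p' ,
  ascending-double-jump (<-trans (n<1+n _) (subst (_< p') (+-comm k 5) k+5<p'))
    (subst (Interfacial p p') (+-comm k 1) i₁) (subst (Interfacial p p') (+-comm k 4) i₄)
    (trans (cong (ρ p p') (+-comm 1 k)) (trans flat (cong (ρ p p') (+-comm k 2))))
  where
  k = suc m
window⇒double-jump (inj₁ refl) (+ 0)      (+≤+ () , _)
window⇒double-jump (inj₁ refl) -[1+ _ ]   (() , _)
window⇒double-jump (inj₂ refl) (+ suc (suc (suc (suc (suc (suc m))))))
                   (_ , +<+ 5+k<p' , _ , _ , _ , i₃ , i₁ , flat) =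
  suc m , s≤s z≤n , ≤-trans (m≤n+m _ 5) 5+k<p' ,
  descending-double-jump (≤-trans (m≤n+m _ 2) 5+k<p') i₁ i₃ flat
window⇒double-jump (inj₂ refl) -[1+ _ ]   (_ , _ , () , _)
window⇒double-jump (inj₂ refl) (+ 0)      (_ , _ , () , _)
window⇒double-jump (inj₂ refl) (+ 1)      (_ , _ , () , _)
window⇒double-jump (inj₂ refl) (+ 2)      (_ , _ , () , _)
window⇒double-jump (inj₂ refl) (+ 3)      (_ , _ , () , _)
window⇒double-jump (inj₂ refl) (+ 4)      (_ , _ , () , _)
window⇒double-jump (inj₂ refl) (+ 5)      (_ , _ , +≤+ () , _)

lemmaE12 : (p p' : ℕ) (cs : List ℕ) → Coprime p p' → 1 ≤ p → p < p' → IsCF p' p cs →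
    ((∃[ c₃ ] ∃[ rest ] cs ≡ 1 ∷ 1 ∷ 1 ∷ c₃ ∷ rest) ⊎ (∃[ c₃ ] cs ≡ 1 ∷ 1 ∷ 2 ∷ c₃ ∷ [])) →
    (Δ : ℤ) → (Δ ≡ + 1 ⊎ Δ ≡ - (+ 1)) →
    ¬ (Σ ℤ λ a →
        (+ 1 Data.Integer.≤ a) × (a Data.Integer.< + p') ×
        (+ 1 Data.Integer.≤ a Data.Integer.+ (+ 5) Data.Integer.* Δ) × (a Data.Integer.+ (+ 5) Data.Integer.* Δ Data.Integer.< + p') ×
        Interfacial p p' ∣ a Data.Integer.+ Δ ∣ ×
        Interfacial p p' ∣ a Data.Integer.+ (+ 2) Data.Integer.* Δ ∣ ×
        Interfacial p p' ∣ a Data.Integer.+ (+ 4) Data.Integer.* Δ ∣ ×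
        ρ p p' ∣ a Data.Integer.+ Δ ∣ ≡ ρ p p' ∣ a Data.Integer.+ (+ 2) Data.Integer.* Δ ∣)
lemmaE12 p p' cs coprime _ _ isCF shape Δ Δ≡±1 (a , window) =
  let k , 0<k , k<p' , double-jump = window⇒double-jump Δ≡±1 a window
  in  ¬beatty-jump 2 5 coprime (IsCF⇒3p'≤5p+1 coprime isCF shape) 0<k k<p' double-jump
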